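{- For $n\ge1$ and $0\le c\le n-1$, we have $|M^{+c}_{3,n}|=c!\,(c+1)^{n-c}\,n!$, where $M^{+c}_{3,n}$ is defined in the context.
   Context: For $n\ge1$, $S_n$ is the set of permutations of $\{0,\dots,n-1\}$ in one-line notation. $S^3_n$ is the set of pairs $\Pi=(\pi^2,\pi^3)$ of elements of $S_n$; its elements are the columns $\Pi_j=(\pi^2_j,\pi^3_j)^T$, and the (sum) level of $\Pi_j$ is $\mathrm{lev}(\Pi_j)=\pi^2_j+\pi^3_j$. Let $\mathrm{lev}_{\max}(\Pi)=\max_j \mathrm{lev}(\Pi_j)$, $m_{3,n}=\min\{\mathrm{lev}_{\max}(\Pi):\Pi\in S^3_n\}$, and $M^{+c}_{3,n}=\{\Pi\in S^3_n: \mathrm{lev}_{\max}(\Pi)\le m_{3,n}+c\}$. -}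

module Defs where

open import Data.Nat using (ℕ; zero; suc; _+_; _≤?_; _⊔_; _⊓_)
open import Data.Fin using (Fin; toℕ)
open import Data.Fin.Properties using (_≟_)
open import Data.Vec using (Vec; []; _∷_; zipWith; toList)
open import Data.Vec.Relation.Unary.Unique.Propositional using (Unique)
open import Data.Vec.Relation.Unary.AllPairs using (allPairs?)
open import Data.List using (List; []; _∷_; concatMap; map; filter; cartesianProduct; foldr; allFin; length)
open import Data.Product using (_×_; _,_)
open import Relation.Nullary using (¬?)

allVecs : (n k : ℕ) → List (Vec (Fin n) k)
allVecs n zero = [] ∷ []
allVecs n (suc k) = concatMap (λ i → map (i ∷_) (allVecs n k)) (allFin n)

-- S_n: permutations of {0,…,n-1} in one-line notation
-- (length-n words over Fin n with pairwise distinct entries).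
Perm : ℕ → Set
Perm n = Vec (Fin n) n

Sn : (n : ℕ) → List (Perm n)
Sn n = filter (allPairs? (λ x y → ¬? (x ≟ y))) (allVecs n n)

S3n : (n : ℕ) → List (Perm n × Perm n)
S3n n = cartesianProduct (Sn n) (Sn n)

levels : {n : ℕ} → Perm n × Perm n → Vec ℕ n
levels (p , q) = zipWith (λ a b → toℕ a + toℕ b) p q

levMax : {n : ℕ} → Perm n × Perm n → ℕ
levMax Π = foldr _⊔_ 0 (toList (levels Π))

-- minimum of a nonempty list (0 on the empty list; never used for n ≥ 1)
minList : List ℕ → ℕ
minList [] = 0
minList (x ∷ xs) = foldr _⊓_ x xs

m3 : ℕ → ℕ
m3 n = minList (map levMax (S3n n))

-- M^{+c}_{3,n} as a list (without repetition) of the elements of S^3_n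
M3 : (n c : ℕ) → List (Perm n × Perm n)
M3 n c = filter (λ Π → levMax Π ≤? m3 n + c) (S3n n)

cardM3 : ℕ → ℕ → ℕ
cardM3 n c = length (M3 n c)

module Submission where

-- A column of Π = (p, q) containing the entry n − 1 of p has level at least n − 1, and
-- (opposite, id) has every level equal to n − 1, so m_{3,n} = n − 1.  Fix p and let σ list
-- the columns of p so that p (σ i) = n − 1 − i.  Reindexing q by σ turns the condition
-- "every level is at most n − 1 + c" into w i ≤ c + i for w = q ∘ σ: every p has the same
-- number h(n, c) of partners, namely the number of such "staircase" permutations w.
-- Choosing the first entry a ≤ c of a staircase permutation of length n + 1 and deleting it
-- (punchOut a) leaves a staircase permutation of length n with the same c, whence
-- h(n + 1, c) = min(n + 1, c + 1) · h(n, c), so h(n, c) = c! (c + 1)^(n − c) for c ≤ n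
-- and h(n, n) = n! = |S_n|.

open import Defs
open import Level using (Level)
open import Function using (_∘_; id; _⇔_; mk⇔; Equivalence)
open import Function.Definitions using (Injective)
open import Data.Nat
  using (ℕ; zero; suc; _+_; _*_; _∸_; _^_; _!; _≤_; _<_; _⊓_; _⊔_; z≤n; s≤s; s≤s⁻¹; _≤?_)
open import Data.Nat.Properties hiding (_≟_)
open import Data.Nat.ListAction using (sum)
import Data.Fin as Fin
open import Data.Fin using (Fin; zero; suc; toℕ; punchIn; punchOut; opposite; fromℕ)
open import Data.Fin.Properties
  using ( _≟_; any?; injective⇒≤; punchIn-injective; punchInᵢ≢i; punchIn-punchOut; punchOut-injective
        ; opposite-prop; opposite-involutive; toℕ<n; toℕ-fromℕ)
open import Data.Vec using (Vec; []; _∷_; lookup; tabulate; toList; allFin) renaming (map to vmap)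
open import Data.Vec.Properties
  using (∷-injective; lookup∘tabulate; tabulate∘lookup; tabulate-cong; lookup-zipWith)
import Data.Vec.Relation.Unary.All as AllV
import Data.Vec.Relation.Unary.All.Properties as AllV
open import Data.Vec.Relation.Unary.AllPairs using (allPairs?; []; _∷_)
open import Data.Vec.Relation.Unary.Unique.Propositional using (Unique)
import Data.Vec.Relation.Unary.Unique.Propositional.Properties as UniqueV
open import Data.List using (List; []; _∷_; map; filter; length; _++_; cartesianProductWith; concatMap)
  renaming (tabulate to tabulateL; allFin to allFinL)
open import Data.List.Properties
  using ( length-map; length-++; filter-++; filter-none; filter-≐; map-tabulate
        ; foldr-preservesᵇ; foldr-preservesᵒ; foldr-forcesᵇ)
import Data.List.Relation.Unary.All as AllL
import Data.List.Relation.Unary.All.Properties as AllL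
import Data.List.Relation.Unary.AllPairs as AllPairsL
import Data.List.Relation.Unary.Any as AnyL
import Data.List.Relation.Unary.Any.Properties as AnyL
open import Data.List.Membership.Propositional using (_∈_; lose)
open import Data.List.Membership.Propositional.Properties
  using ( ∈-map⁺; ∈-map⁻; ∈-filter⁺; ∈-filter⁻; ∈-allFin
        ; ∈-cartesianProductWith⁺; ∈-cartesianProduct⁺; ∈-cartesianProduct⁻)
open import Data.List.Membership.Propositional.Properties.WithK using (unique∧set⇒bag)
import Data.List.Relation.Unary.Unique.Propositional as UniqueL
import Data.List.Relation.Unary.Unique.Propositional.Properties as UniqueL
open import Data.List.Relation.Binary.BagAndSetEquality using (∼bag⇒↭)
open import Data.List.Relation.Binary.Permutation.Propositional.Properties using (↭-length)
open import Data.Product using (_×_; _,_; proj₁; proj₂; ∃; Σ-syntax)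
open import Data.Sum using ([_,_])
open import Data.Unit using (⊤; tt)
open import Data.Bool using (true; false)
open import Relation.Nullary using (yes; no; ¬?; contradiction; does)
open import Relation.Nullary.Decidable using (_×-dec_)
open import Relation.Unary using (Pred; Decidable; _≐_)
open import Relation.Binary.PropositionalEquality hiding ([_])

private
  variable
    ℓ ℓ₁ ℓ₂ ℓ₃ : Level
    A : Set ℓ₁
    B : Set ℓ₂
    C : Set ℓ₃

length-filter-map : ∀ {P : Pred B ℓ} (P? : Decidable P) (f : A → B) xs →
                    length (filter P? (map f xs)) ≡ length (filter (P? ∘ f) xs)
length-filter-map P? f [] = refl
length-filter-map P? f (x ∷ xs) with does (P? (f x))
... | true  = cong suc (length-filter-map P? f xs)
... | false = length-filter-map P? f xs

length-filter-cartesianProductWith : ∀ {P : Pred C ℓ} (P? : Decidable P) (f : A → B → C) xs ys →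
  length (filter P? (cartesianProductWith f xs ys)) ≡ sum (map (λ x → length (filter (P? ∘ f x) ys)) xs)
length-filter-cartesianProductWith P? f [] ys = refl
length-filter-cartesianProductWith P? f (x ∷ xs) ys =
  trans (cong length (filter-++ P? (map (f x) ys) _))
  (trans (length-++ (filter P? (map (f x) ys)))
         (cong₂ _+_ (length-filter-map P? (f x) ys) (length-filter-cartesianProductWith P? f xs ys)))

sum-map-const : ∀ (f : A → ℕ) {k} xs → (∀ {x} → x ∈ xs → f x ≡ k) → sum (map f xs) ≡ length xs * k
sum-map-const f []       _      = refl
sum-map-const f (x ∷ xs) fxs≡k =
  cong₂ _+_ (fxs≡k (AnyL.here refl)) (sum-map-const f xs (fxs≡k ∘ AnyL.there))

sum-tabulate-indicator : ∀ {M} t {X} (f : Fin M → ℕ) →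
  (∀ a → toℕ a < t → f a ≡ X) → (∀ a → t ≤ toℕ a → f a ≡ 0) → sum (tabulateL f) ≡ (M ⊓ t) * X
sum-tabulate-indicator {zero}  t           f _   _   = refl
sum-tabulate-indicator {suc M} zero    {X} f _   f≡0 =
  cong₂ _+_ (f≡0 zero z≤n)
    (trans (sum-tabulate-indicator zero (f ∘ Fin.suc) (λ _ ()) (λ a _ → f≡0 (suc a) z≤n))
           (cong (_* X) (⊓-zeroʳ M)))
sum-tabulate-indicator {suc M} (suc t)     f f≡X f≡0 =
  cong₂ _+_ (f≡X zero (s≤s z≤n))
    (sum-tabulate-indicator t (f ∘ Fin.suc) (λ a a<t → f≡X (suc a) (s≤s a<t))
                                            (λ a t≤a → f≡0 (suc a) (s≤s t≤a)))

retraction⇒injective : ∀ (f : A → B) (g : B → A) → (∀ x → g (f x) ≡ x) → Injective _≡_ _≡_ f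
retraction⇒injective f g gf≡id {x} {y} fx≡fy = trans (sym (gf≡id x)) (trans (cong g fx≡fy) (gf≡id y))

injective∧onto⇒length-≡ : ∀ {xs : List A} {ys : List B} (f : A → B) → Injective _≡_ _≡_ f →
  UniqueL.Unique xs → UniqueL.Unique ys →
  (∀ {x} → x ∈ xs → f x ∈ ys) → (∀ {y} → y ∈ ys → ∃ λ x → x ∈ xs × f x ≡ y) →
  length xs ≡ length ys
injective∧onto⇒length-≡ {xs = xs} {ys} f f-inj xs! ys! into onto = trans (sym (length-map f xs))
  (↭-length (∼bag⇒↭ (unique∧set⇒bag (UniqueL.map⁺ f-inj xs!) ys! (mk⇔ to from))))
  where
  to : ∀ {y} → y ∈ map f xs → y ∈ ys
  to y∈ with _ , x∈ , refl ← ∈-map⁻ f y∈ = into x∈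
  from : ∀ {y} → y ∈ ys → y ∈ map f xs
  from y∈ with _ , x∈ , refl ← onto y∈ = ∈-map⁺ f x∈

minList-≡ : ∀ {b} xs → AllL.All (b ≤_) xs → AnyL.Any (_≤ b) xs → minList xs ≡ b
minList-≡ {b} (x ∷ xs) (b≤x AllL.∷ b≤xs) some≤b = ≤-antisym
  (foldr-preservesᵒ {P = _≤ b} (λ y z → [ m≤n⇒m⊓o≤n z , m≤n⇒o⊓m≤n y ]) x xs (AnyL.toSum some≤b))
  (foldr-preservesᵇ {P = b ≤_} ⊓-glb b≤x b≤xs)

shift-≤⇔ : ∀ {o i N} x c → o + i ≡ N → o + x ≤ N + c ⇔ x ≤ c + i
shift-≤⇔ {o} {i} x c refl = mk⇔ (+-cancelˡ-≤ o x (c + i) ∘ subst (o + x ≤_) regroup)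
                                  (subst (o + x ≤_) (sym regroup) ∘ +-monoʳ-≤ o)
  where
  regroup : o + i + c ≡ o + (c + i)
  regroup = trans (+-assoc o i c) (cong (o +_) (+-comm i c))

toℕ-opposite-+ : ∀ {n} (i : Fin (suc n)) → toℕ (opposite i) + toℕ i ≡ n
toℕ-opposite-+ i = trans (cong (_+ toℕ i) (opposite-prop i)) (m∸n+n≡m (s≤s⁻¹ (toℕ<n i)))

opposite-injective : ∀ {n} → Injective _≡_ _≡_ (opposite {n})
opposite-injective = retraction⇒injective opposite opposite opposite-involutive

injective⇒surjective : ∀ {n} {f : Fin n → Fin n} → Injective _≡_ _≡_ f → ∀ y → ∃ λ x → f x ≡ y
injective⇒surjective {suc n} {f} f-inj y with any? (λ x → f x ≟ y)
... | yes y∈image = y∈image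
... | no  y∉image = contradiction (injective⇒≤ punchOut∘f-injective) (1+n≰n {n})
  where
  y≢f : ∀ x → y ≢ f x
  y≢f x y≡fx = y∉image (x , sym y≡fx)
  punchOut∘f-injective : ∀ {i j} → punchOut (y≢f i) ≡ punchOut (y≢f j) → i ≡ j
  punchOut∘f-injective eq = f-inj (punchOut-injective (y≢f _) (y≢f _) eq)

toℕ-punchIn-≤⁺ : ∀ {m d} (a : Fin (suc m)) (x : Fin m) →
                 toℕ a ≤ d → toℕ x ≤ d → toℕ (punchIn a x) ≤ suc d
toℕ-punchIn-≤⁺ zero    x       _         x≤d       = s≤s x≤d
toℕ-punchIn-≤⁺ (suc a) zero    _         _         = z≤n
toℕ-punchIn-≤⁺ (suc a) (suc x) (s≤s a≤d) (s≤s x≤d) = s≤s (toℕ-punchIn-≤⁺ a x a≤d x≤d)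

toℕ-punchIn-≤⁻ : ∀ {m d} (a : Fin (suc m)) (x : Fin m) →
                 toℕ a ≤ d → toℕ (punchIn a x) ≤ suc d → toℕ x ≤ d
toℕ-punchIn-≤⁻ zero    x       _         (s≤s x≤d) = x≤d
toℕ-punchIn-≤⁻ (suc a) zero    _         _         = z≤n
toℕ-punchIn-≤⁻ (suc a) (suc x) (s≤s a≤d) (s≤s x≤d) = s≤s (toℕ-punchIn-≤⁻ a x a≤d x≤d)

map-punchIn-onto : ∀ {m k} {a : Fin (suc m)} {w : Vec (Fin (suc m)) k} →
                   AllV.All (a ≢_) w → Σ[ w′ ∈ Vec (Fin m) k ] vmap (punchIn a) w′ ≡ w
map-punchIn-onto AllV.[]           = [] , refl
map-punchIn-onto (a≢x AllV.∷ a∉w) =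
  let w′ , eq = map-punchIn-onto a∉w in punchOut a≢x ∷ w′ , cong₂ _∷_ (punchIn-punchOut a≢x) eq

map-injective : ∀ {f : A → B} {k} → Injective _≡_ _≡_ f → Injective _≡_ _≡_ (vmap {n = k} f)
map-injective f-inj {[]}     {[]}     _  = refl
map-injective f-inj {x ∷ xs} {y ∷ ys} eq =
  let x≡y , xs≡ys = ∷-injective eq in cong₂ _∷_ (f-inj x≡y) (map-injective f-inj xs≡ys)

Unique-map⁻ : ∀ (f : A → B) {k} {xs : Vec A k} → Unique (vmap f xs) → Unique xs
Unique-map⁻ f {xs = []}    []           = []
Unique-map⁻ f {xs = _ ∷ _} (fx∉ ∷ fxs!) = AllV.map (_∘ cong f) (AllV.map⁻ fx∉) ∷ Unique-map⁻ f fxs!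

reindex : ∀ {n} → (Fin n → Fin n) → Vec A n → Vec A n
reindex σ v = tabulate (lookup v ∘ σ)

lookup-reindex : ∀ {n} (σ : Fin n → Fin n) (v : Vec A n) i → lookup (reindex σ v) i ≡ lookup v (σ i)
lookup-reindex σ v = lookup∘tabulate (lookup v ∘ σ)

reindex-reindex : ∀ {n} (σ τ : Fin n → Fin n) → (∀ i → σ (τ i) ≡ i) →
                  (v : Vec A n) → reindex τ (reindex σ v) ≡ v
reindex-reindex σ τ στ≡id v = trans
  (tabulate-cong (λ i → trans (lookup-reindex σ v (τ i)) (cong (lookup v) (στ≡id i))))
  (tabulate∘lookup v)

Unique-reindex : ∀ {n} {σ : Fin n → Fin n} → Injective _≡_ _≡_ σ →
                 ∀ {v : Vec A n} → Unique v → Unique (reindex σ v)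
Unique-reindex σ-inj v! = UniqueV.tabulate⁺ (σ-inj ∘ UniqueV.lookup-injective v! _ _)

allVecs-suc : ∀ n k → allVecs n (suc k) ≡ cartesianProductWith _∷_ (allFinL n) (allVecs n k)
allVecs-suc n k = concatMap≡cartesianProductWith (allFinL n)
  where
  concatMap≡cartesianProductWith : ∀ xs →
    concatMap (λ x → map (x ∷_) (allVecs n k)) xs ≡ cartesianProductWith _∷_ xs (allVecs n k)
  concatMap≡cartesianProductWith []       = refl
  concatMap≡cartesianProductWith (x ∷ xs) =
    cong (map (x ∷_) (allVecs n k) ++_) (concatMap≡cartesianProductWith xs)

allVecs-unique : ∀ n k → UniqueL.Unique (allVecs n k)
allVecs-unique n zero    = AllL.[] AllPairsL.∷ AllPairsL.[]
allVecs-unique n (suc k) rewrite allVecs-suc n k =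
  UniqueL.cartesianProductWith⁺ _∷_ ∷-injective (UniqueL.allFin⁺ n) (allVecs-unique n k)

∈-allVecs : ∀ {n k} (v : Vec (Fin n) k) → v ∈ allVecs n k
∈-allVecs []                  = AnyL.here refl
∈-allVecs {n} {suc k} (x ∷ v) rewrite allVecs-suc n k =
  ∈-cartesianProductWith⁺ _∷_ (∈-allFin x) (∈-allVecs v)

∈-filter-allVecs⁺ : ∀ {n k} {P : Pred (Vec (Fin n) k) ℓ} (P? : Decidable P) {v} →
                    P v → v ∈ filter P? (allVecs n k)
∈-filter-allVecs⁺ P? {v} = ∈-filter⁺ P? (∈-allVecs v)

∈-filter-allVecs⁻ : ∀ {n k} {P : Pred (Vec (Fin n) k) ℓ} (P? : Decidable P) {v} →
                    v ∈ filter P? (allVecs n k) → P v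
∈-filter-allVecs⁻ {n = n} {k = k} P? v∈ = proj₂ (∈-filter⁻ P? {xs = allVecs n k} v∈)

unique? : ∀ {m k} → Decidable (Unique {A = Fin m} {n = k})
unique? = allPairs? (λ x y → ¬? (x ≟ y))

Staircase : ∀ {m k} → ℕ → Vec (Fin m) k → Set
Staircase c []       = ⊤
Staircase c (x ∷ xs) = toℕ x ≤ c × Staircase (suc c) xs

staircase? : ∀ {m k} c → Decidable (Staircase {m} {k} c)
staircase? c []       = yes tt
staircase? c (x ∷ xs) = (toℕ x ≤? c) ×-dec staircase? (suc c) xs

staircase-lookup⁺ : ∀ {m k c} (v : Vec (Fin m) k) → Staircase c v → ∀ i → toℕ (lookup v i) ≤ c + toℕ i
staircase-lookup⁺ {c = c} (x ∷ v) (x≤c , _)  zero    = subst (toℕ x ≤_) (sym (+-identityʳ c)) x≤c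
staircase-lookup⁺ {c = c} (x ∷ v) (_   , v↑) (suc i) =
  subst (toℕ (lookup v i) ≤_) (sym (+-suc c (toℕ i))) (staircase-lookup⁺ v v↑ i)

staircase-lookup⁻ : ∀ {m k c} (v : Vec (Fin m) k) → (∀ i → toℕ (lookup v i) ≤ c + toℕ i) → Staircase c v
staircase-lookup⁻         []      _  = tt
staircase-lookup⁻ {c = c} (x ∷ v) v≤ =
  subst (toℕ x ≤_) (+-identityʳ c) (v≤ zero) ,
  staircase-lookup⁻ v (λ i → subst (toℕ (lookup v i) ≤_) (+-suc c (toℕ i)) (v≤ (suc i)))

m≤1+c⇒staircase : ∀ {m k c} (v : Vec (Fin m) k) → m ≤ suc c → Staircase c v
m≤1+c⇒staircase []      _     = tt
m≤1+c⇒staircase (x ∷ v) m≤1+c =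
  s≤s⁻¹ (≤-trans (toℕ<n x) m≤1+c) , m≤1+c⇒staircase v (m≤n⇒m≤1+n m≤1+c)

staircase-punchIn⁺ : ∀ {m k d} (a : Fin (suc m)) (w : Vec (Fin m) k) → toℕ a ≤ d →
                     Staircase d w → Staircase (suc d) (vmap (punchIn a) w)
staircase-punchIn⁺ a []      _   _          = tt
staircase-punchIn⁺ a (x ∷ w) a≤d (x≤d , w↑) =
  toℕ-punchIn-≤⁺ a x a≤d x≤d , staircase-punchIn⁺ a w (m≤n⇒m≤1+n a≤d) w↑

staircase-punchIn⁻ : ∀ {m k d} (a : Fin (suc m)) (w : Vec (Fin m) k) → toℕ a ≤ d →
                     Staircase (suc d) (vmap (punchIn a) w) → Staircase d w
staircase-punchIn⁻ a []      _   _          = tt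
staircase-punchIn⁻ a (x ∷ w) a≤d (x≤d , w↑) =
  toℕ-punchIn-≤⁻ a x a≤d x≤d , staircase-punchIn⁻ a w (m≤n⇒m≤1+n a≤d) w↑

UniqueStaircase : ∀ {m k} → ℕ → Vec (Fin m) k → Set
UniqueStaircase c w = Unique w × Staircase c w

uniqueStaircase? : ∀ {m k} c → Decidable (UniqueStaircase {m} {k} c)
uniqueStaircase? c w = unique? w ×-dec staircase? c w

staircaseCount : ℕ → ℕ → ℕ
staircaseCount n c = length (filter (uniqueStaircase? c) (allVecs n n))

staircaseCount-fibre : ∀ n c (a : Fin (suc n)) → toℕ a ≤ c →
  length (filter (uniqueStaircase? c ∘ (a ∷_)) (allVecs (suc n) n)) ≡ staircaseCount n c
staircaseCount-fibre n c a a≤c = sym (injective∧onto⇒length-≡ (vmap (punchIn a))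
  (map-injective (punchIn-injective a _ _))
  (UniqueL.filter⁺ (uniqueStaircase? c) (allVecs-unique n n))
  (UniqueL.filter⁺ (uniqueStaircase? c ∘ (a ∷_)) (allVecs-unique (suc n) n))
  into onto)
  where
  into : ∀ {w} → w ∈ filter (uniqueStaircase? c) (allVecs n n) →
         vmap (punchIn a) w ∈ filter (uniqueStaircase? c ∘ (a ∷_)) (allVecs (suc n) n)
  into {w} w∈ with w! , w↑ ← ∈-filter-allVecs⁻ (uniqueStaircase? c) w∈ =
    ∈-filter-allVecs⁺ (uniqueStaircase? c ∘ (a ∷_))
      ( AllV.map⁺ (AllV.universal (λ x → punchInᵢ≢i a x ∘ sym) w) ∷ UniqueV.map⁺ (punchIn-injective a _ _) w!
      , a≤c , staircase-punchIn⁺ a w a≤c w↑)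
  preimage : ∀ {w} → UniqueStaircase c (a ∷ w) →
             ∃ λ w′ → w′ ∈ filter (uniqueStaircase? c) (allVecs n n) × vmap (punchIn a) w′ ≡ w
  preimage (a∉w ∷ w! , _ , w↑) with w′ , refl ← map-punchIn-onto a∉w =
    w′ , ∈-filter-allVecs⁺ (uniqueStaircase? c) (Unique-map⁻ (punchIn a) w! , staircase-punchIn⁻ a w′ a≤c w↑)
       , refl
  onto : ∀ {w} → w ∈ filter (uniqueStaircase? c ∘ (a ∷_)) (allVecs (suc n) n) →
         ∃ λ w′ → w′ ∈ filter (uniqueStaircase? c) (allVecs n n) × vmap (punchIn a) w′ ≡ w
  onto = preimage ∘ ∈-filter-allVecs⁻ (uniqueStaircase? c ∘ (a ∷_))

staircaseCount-suc : ∀ n c → staircaseCount (suc n) c ≡ (suc n ⊓ suc c) * staircaseCount n c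
staircaseCount-suc n c = begin
  staircaseCount (suc n) c
    ≡⟨ cong (length ∘ filter (uniqueStaircase? c)) (allVecs-suc (suc n) n) ⟩
  length (filter (uniqueStaircase? c) (cartesianProductWith _∷_ (allFinL (suc n)) (allVecs (suc n) n)))
    ≡⟨ length-filter-cartesianProductWith (uniqueStaircase? c) _∷_ (allFinL (suc n)) (allVecs (suc n) n) ⟩
  sum (map fibre (allFinL (suc n)))
    ≡⟨ cong sum (map-tabulate id fibre) ⟩
  sum (tabulateL fibre)
    ≡⟨ sum-tabulate-indicator (suc c) fibre (λ a → staircaseCount-fibre n c a ∘ s≤s⁻¹) fibre-empty ⟩
  (suc n ⊓ suc c) * staircaseCount n c ∎
  where
  open ≡-Reasoning
  fibre : Fin (suc n) → ℕ
  fibre a = length (filter (uniqueStaircase? c ∘ (a ∷_)) (allVecs (suc n) n))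
  fibre-empty : ∀ a → suc c ≤ toℕ a → fibre a ≡ 0
  fibre-empty a c<a = cong length (filter-none (uniqueStaircase? c ∘ (a ∷_))
    (AllL.universal (λ _ (_ , a≤c , _) → <⇒≱ c<a a≤c) (allVecs (suc n) n)))

staircaseCount-≤ : ∀ n c → n ≤ c → staircaseCount n c ≡ n !
staircaseCount-≤ zero    c _   = refl
staircaseCount-≤ (suc n) c n<c = begin
  staircaseCount (suc n) c              ≡⟨ staircaseCount-suc n c ⟩
  (suc n ⊓ suc c) * staircaseCount n c  ≡⟨ cong₂ _*_ (m≤n⇒m⊓n≡m (m≤n⇒m≤1+n n<c))
                                                       (staircaseCount-≤ n c (<⇒≤ n<c)) ⟩
  suc n * n !                           ∎
  where open ≡-Reasoning

staircaseCount-+ : ∀ d c → staircaseCount (d + c) c ≡ suc c ^ d * c !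
staircaseCount-+ zero    c = trans (staircaseCount-≤ c c ≤-refl) (sym (+-identityʳ (c !)))
staircaseCount-+ (suc d) c = begin
  staircaseCount (suc (d + c)) c                   ≡⟨ staircaseCount-suc (d + c) c ⟩
  (suc (d + c) ⊓ suc c) * staircaseCount (d + c) c ≡⟨ cong₂ _*_ (m≥n⇒m⊓n≡n (s≤s (m≤n+m c d)))
                                                                  (staircaseCount-+ d c) ⟩
  suc c * (suc c ^ d * c !)                        ≡⟨ *-assoc (suc c) (suc c ^ d) (c !) ⟨
  suc c ^ suc d * c !                              ∎
  where open ≡-Reasoning

staircaseCount-closed : ∀ {n c} → c ≤ n → staircaseCount n c ≡ c ! * (c + 1) ^ (n ∸ c)
staircaseCount-closed {n} {c} c≤n = begin
  staircaseCount n c           ≡⟨ cong (λ m → staircaseCount m c) (m∸n+n≡m c≤n) ⟨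
  staircaseCount (n ∸ c + c) c ≡⟨ staircaseCount-+ (n ∸ c) c ⟩
  suc c ^ (n ∸ c) * c !        ≡⟨ *-comm (suc c ^ (n ∸ c)) (c !) ⟩
  c ! * suc c ^ (n ∸ c)        ≡⟨ cong (λ b → c ! * b ^ (n ∸ c)) (+-comm 1 c) ⟩
  c ! * (c + 1) ^ (n ∸ c)      ∎
  where open ≡-Reasoning

length-Sn : ∀ n → length (Sn n) ≡ n !
length-Sn n = trans (cong length (filter-≐ unique? (uniqueStaircase? n) unique≐uniqueStaircase (allVecs n n)))
                    (staircaseCount-≤ n n ≤-refl)
  where
  unique≐uniqueStaircase : Unique {n = n} ≐ UniqueStaircase {n} n
  unique≐uniqueStaircase = (λ {v} v! → v! , m≤1+c⇒staircase v (n≤1+n n)) , proj₁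

levMax≤⇔ : ∀ {n} (p q : Perm n) {K} →
           levMax (p , q) ≤ K ⇔ (∀ j → toℕ (lookup p j) + toℕ (lookup q j) ≤ K)
levMax≤⇔ p q {K} = mk⇔ to from
  where
  column : ∀ j → lookup (levels (p , q)) j ≡ toℕ (lookup p j) + toℕ (lookup q j)
  column j = lookup-zipWith _ j p q
  split : ∀ x y → x ⊔ y ≤ K → x ≤ K × y ≤ K
  split x y x⊔y≤K = m⊔n≤o⇒m≤o x y x⊔y≤K , m⊔n≤o⇒n≤o x y x⊔y≤K
  to : levMax (p , q) ≤ K → ∀ j → toℕ (lookup p j) + toℕ (lookup q j) ≤ K
  to max≤K j = subst (_≤ K) (column j)
    (AllV.lookup⁺ (AllV.toList⁻ (foldr-forcesᵇ {P = _≤ K} split 0 (toList (levels (p , q))) max≤K)) j)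
  from : (∀ j → toℕ (lookup p j) + toℕ (lookup q j) ≤ K) → levMax (p , q) ≤ K
  from columns≤K = foldr-preservesᵇ {P = _≤ K} ⊔-lub {xs = toList (levels (p , q))} z≤n
    (AllV.toList⁺ (AllV.lookup⁻ (λ j → subst (_≤ K) (sym (column j)) (columns≤K j))))

levMax-lower : ∀ {n} (p q : Perm (suc n)) → Unique p → n ≤ levMax (p , q)
levMax-lower {n} p q p! with j , pj≡n ← injective⇒surjective (UniqueV.lookup-injective p! _ _) (fromℕ n) = begin
  n                                   ≡⟨ toℕ-fromℕ n ⟨
  toℕ (fromℕ n)                       ≡⟨ cong toℕ pj≡n ⟨
  toℕ (lookup p j)                    ≤⟨ m≤m+n _ _ ⟩
  toℕ (lookup p j) + toℕ (lookup q j) ≤⟨ Equivalence.to (levMax≤⇔ p q) ≤-refl j ⟩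
  levMax (p , q)                      ∎
  where open ≤-Reasoning

m3-suc : ∀ n → m3 (suc n) ≡ n
m3-suc n = minList-≡ (map levMax (S3n (suc n))) (AllL.map⁺ (AllL.tabulate lower))
                     (AnyL.map⁺ (lose attained attains))
  where
  opposites ids : Perm (suc n)
  opposites = tabulate opposite
  ids       = allFin (suc n)
  attained : (opposites , ids) ∈ S3n (suc n)
  attained = ∈-cartesianProduct⁺ (∈-filter-allVecs⁺ unique? (UniqueV.tabulate⁺ opposite-injective))
                                 (∈-filter-allVecs⁺ unique? (UniqueV.tabulate⁺ id))
  attains : levMax (opposites , ids) ≤ n
  attains = Equivalence.from (levMax≤⇔ opposites ids) λ j → ≤-reflexive (trans
    (cong₂ (λ a b → toℕ a + toℕ b) (lookup∘tabulate opposite j) (lookup∘tabulate id j)) (toℕ-opposite-+ j))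
  lower : ∀ {Π} → Π ∈ S3n (suc n) → n ≤ levMax Π
  lower {p , q} Π∈ =
    levMax-lower p q (∈-filter-allVecs⁻ unique? (proj₁ (∈-cartesianProduct⁻ (Sn (suc n)) (Sn (suc n)) Π∈)))

levMax≤⇔staircase : ∀ {n} (p q : Perm (suc n)) (σ τ : Fin (suc n) → Fin (suc n)) →
  (∀ i → lookup p (σ i) ≡ opposite i) → (∀ j → σ (τ j) ≡ j) →
  ∀ c → levMax (p , q) ≤ n + c ⇔ Staircase c (reindex σ q)
levMax≤⇔staircase {n} p q σ τ pσ≡opposite στ≡id c = mk⇔
  (λ compat → staircase-lookup⁻ (reindex σ q) λ i →
    subst (λ x → toℕ x ≤ c + toℕ i) (sym (lookup-reindex σ q i))
      (Equivalence.to (shift-≤⇔ _ c (toℕ-opposite-+ i))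
        (subst (λ x → toℕ x + toℕ (lookup q (σ i)) ≤ n + c) (pσ≡opposite i)
          (Equivalence.to (levMax≤⇔ p q) compat (σ i)))))
  (λ σq↑ → Equivalence.from (levMax≤⇔ p q) λ j →
    subst (λ i → toℕ (lookup p i) + toℕ (lookup q i) ≤ n + c) (στ≡id j)
      (Equivalence.from (shift-≤⇔ _ c (trans (cong (λ x → toℕ x + _) (pσ≡opposite (τ j)))
                                             (toℕ-opposite-+ (τ j))))
        (subst (λ x → toℕ x ≤ c + toℕ (τ j)) (lookup-reindex σ q (τ j))
          (staircase-lookup⁺ (reindex σ q) σq↑ (τ j)))))

length-filter-levMax≤ : ∀ {n} (p : Perm (suc n)) → Unique p → ∀ c →
  length (filter (λ q → levMax (p , q) ≤? n + c) (Sn (suc n))) ≡ staircaseCount (suc n) c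
length-filter-levMax≤ {n} p p! c = injective∧onto⇒length-≡ (reindex σ)
  (retraction⇒injective (reindex σ) (reindex τ) (reindex-reindex σ τ στ≡id))
  (UniqueL.filter⁺ compatible? (UniqueL.filter⁺ unique? (allVecs-unique (suc n) (suc n))))
  (UniqueL.filter⁺ (uniqueStaircase? c) (allVecs-unique (suc n) (suc n)))
  into onto
  where
  compatible? : Decidable (λ q → levMax (p , q) ≤ n + c)
  compatible? q = levMax (p , q) ≤? n + c
  p-inj : Injective _≡_ _≡_ (lookup p)
  p-inj = UniqueV.lookup-injective p! _ _
  σ τ : Fin (suc n) → Fin (suc n)
  σ i = proj₁ (injective⇒surjective p-inj (opposite i))
  τ j = opposite (lookup p j)
  pσ≡opposite : ∀ i → lookup p (σ i) ≡ opposite i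
  pσ≡opposite i = proj₂ (injective⇒surjective p-inj (opposite i))
  τσ≡id : ∀ i → τ (σ i) ≡ i
  τσ≡id i = trans (cong opposite (pσ≡opposite i)) (opposite-involutive i)
  στ≡id : ∀ j → σ (τ j) ≡ j
  στ≡id j = p-inj (trans (pσ≡opposite (τ j)) (opposite-involutive (lookup p j)))
  compatible⇔staircase : ∀ q → levMax (p , q) ≤ n + c ⇔ Staircase c (reindex σ q)
  compatible⇔staircase q = levMax≤⇔staircase p q σ τ pσ≡opposite στ≡id c
  into : ∀ {q} → q ∈ filter compatible? (Sn (suc n)) →
         reindex σ q ∈ filter (uniqueStaircase? c) (allVecs (suc n) (suc n))
  into {q} q∈ with q∈Sn , compat ← ∈-filter⁻ compatible? {xs = Sn (suc n)} q∈ =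
    ∈-filter-allVecs⁺ (uniqueStaircase? c)
      ( Unique-reindex (retraction⇒injective σ τ τσ≡id) (∈-filter-allVecs⁻ unique? q∈Sn)
      , Equivalence.to (compatible⇔staircase q) compat)
  onto : ∀ {y} → y ∈ filter (uniqueStaircase? c) (allVecs (suc n) (suc n)) →
         ∃ λ q → q ∈ filter compatible? (Sn (suc n)) × reindex σ q ≡ y
  onto {y} y∈ with y! , y↑ ← ∈-filter-allVecs⁻ (uniqueStaircase? c) y∈ =
    reindex τ y ,
    ∈-filter⁺ compatible? (∈-filter-allVecs⁺ unique? (Unique-reindex (retraction⇒injective τ σ στ≡id) y!))
      (Equivalence.from (compatible⇔staircase (reindex τ y)) (subst (Staircase c) (sym σ∘τ-y) y↑)) ,
    σ∘τ-y
    where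
    σ∘τ-y : reindex σ (reindex τ y) ≡ y
    σ∘τ-y = reindex-reindex τ σ τσ≡id y

theorem4p14 : (n c : ℕ) → 1 ≤ n → c ≤ n ∸ 1 →
    cardM3 n c ≡ (c !) * ((c + 1) ^ (n ∸ c)) * (n !)
theorem4p14 (suc n) c _ c≤n = begin
  cardM3 (suc n) c
    ≡⟨ cong (λ m → length (filter (λ Π → levMax Π ≤? m + c) (S3n (suc n)))) (m3-suc n) ⟩
  length (filter (λ Π → levMax Π ≤? n + c) (S3n (suc n)))
    ≡⟨ length-filter-cartesianProductWith (λ Π → levMax Π ≤? n + c) _,_ (Sn (suc n)) (Sn (suc n)) ⟩
  sum (map (λ p → length (filter (λ q → levMax (p , q) ≤? n + c) (Sn (suc n)))) (Sn (suc n)))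
    ≡⟨ sum-map-const _ (Sn (suc n)) (λ p∈ → length-filter-levMax≤ _ (∈-filter-allVecs⁻ unique? p∈) c) ⟩
  length (Sn (suc n)) * staircaseCount (suc n) c
    ≡⟨ cong₂ _*_ (length-Sn (suc n)) (staircaseCount-closed (m≤n⇒m≤1+n c≤n)) ⟩
  suc n ! * (c ! * (c + 1) ^ (suc n ∸ c))
    ≡⟨ *-comm (suc n !) _ ⟩
  c ! * (c + 1) ^ (suc n ∸ c) * suc n !
    ∎
  where open ≡-Reasoning
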